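{- Let $F$ be a face of a triangulation $\Gamma$. If $\Gamma$ is locally $z$-knotted for $F$, then every zigzag from $\mathcal Z(F)$ passes through each edge of $F$ twice. Conversely, if there is a zigzag passing through each edge of $F$ twice, then $\Gamma$ is locally $z$-knotted for $F$.
   Context: A triangulation is a connected simple finite graph embedded in a connected closed $2$-dimensional surface such that every face (closure of a component of the complement) is a closed $2$-disc with exactly three edges, every edge lies in exactly two distinct faces, and two distinct faces meet in an edge, a vertex, or not at all. Two distinct edges are adjacent if they share a vertex and lie in a common face. A zigzag is a sequence of edges $(e_i)_{i\in\mathbb N}$ with $e_i,e_{i+1}$ adjacent and the face containing $e_i,e_{i+1}$ distinct from the face containing $e_{i+1},e_{i+2}$, for all $i$; it is periodic and regarded as a cyclic sequence (one period), and "passes through an edge twice" refers to occurrences in one period; written as a cyclic sequence of vertices, each passage through an edge has a direction. Its reverse is also a zigzag. For a face $F$ with vertices $a,b,c$, $\Omega(F)=\{ab,bc,ca,ac,cb,ba\}$ (oriented edges) and $D_F=(ab,bc,ca)(ac,cb,ba)$. $\mathcal Z(F)$ is the set of all zigzags containing consecutive oriented edges $e,D_F(e)$ for some $e\in\Omega(F)$. $\Gamma$ is locally $z$-knotted for $F$ if $|\mathcal Z(F)|=2$. -}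

module Defs where

open import Data.Nat using (ℕ; zero; suc; _+_; _≤_; _<_)
open import Data.Fin using (Fin) renaming (_≟_ to _≟ᶠ_)
open import Data.Product using (Σ; ∃; ∃-syntax; _×_; _,_)
open import Data.Sum using (_⊎_)
open import Data.List using (List; length; filter; upTo)
open import Relation.Binary.PropositionalEquality using (_≡_; _≢_)
open import Relation.Nullary using (¬_; Dec)
open import Relation.Nullary.Decidable using (_×-dec_; _⊎-dec_)
open import Function.Definitions using (Injective)

-- Combinatorial triangulations of closed connected surfaces.
-- Vertices are Fin n, faces are Fin m; face f has the three corners
-- corner f 0, corner f 1, corner f 2.

module _ {n m : ℕ} (corner : Fin m → Fin 3 → Fin n) where

  InFace : Fin m → Fin n → Set
  InFace f x = ∃[ j ] corner f j ≡ x

  Adj : Fin n → Fin n → Set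
  Adj x y = x ≢ y × ∃[ f ] (InFace f x × InFace f y)

  data Reach : Fin n → Fin n → Set where
    here : ∀ {x} → Reach x x
    step : ∀ {x y z} → Adj x y → Reach y z → Reach x z

  AdjAt : Fin n → Fin m → Fin m → Set
  AdjAt v f g = ∃[ w ] (w ≢ v × InFace f w × InFace g w)

  data ReachAt (v : Fin n) : Fin m → Fin m → Set where
    here : ∀ {f} → ReachAt v f f
    step : ∀ {f g h} → InFace g v → AdjAt v f g → ReachAt v g h → ReachAt v f h

record Triangulation : Set where
  field
    n m       : ℕ
    corner    : Fin m → Fin 3 → Fin n
    corner-inj : ∀ f → Injective _≡_ _≡_ (corner f)
    -- distinct faces have distinct vertex sets (two distinct faces meet in
    -- an edge, a vertex, or not at all)
    faces-distinct : ∀ f g → f ≢ g → ¬ (∀ x → InFace corner f x → InFace corner g x)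
    covered   : ∀ x → ∃[ f ] InFace corner f x
    two-faces : ∀ x y → Adj corner x y →
                ∃[ f ] ∃[ g ] (f ≢ g × (InFace corner f x × InFace corner f y)
                                      × (InFace corner g x × InFace corner g y)
                               × (∀ h → InFace corner h x → InFace corner h y → h ≡ f ⊎ h ≡ g))
    connected : ∀ x y → Reach corner x y
    -- the surface condition: the link of every vertex is connected
    -- (hence, with two-faces, a single cycle)
    link-connected : ∀ v f g → InFace corner f v → InFace corner g v → ReachAt corner v f g

module _ (T : Triangulation) where
  open Triangulation T

  Spans : Fin m → Fin n → Fin n → Fin n → Set
  Spans f x y z = (x ≢ y × y ≢ z × x ≢ z)
                × (InFace corner f x × InFace corner f y × InFace corner f z)

  -- A zigzag, written as its (infinite) sequence of vertices x₀ x₁ x₂ …;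
  -- the edges are e_i = x_i x_{i+1}.
  Zigzag : (ℕ → Fin n) → Set
  Zigzag z = (∀ i → ∃[ f ] Spans f (z i) (z (1 + i)) (z (2 + i)))
           × (∀ i f g → Spans f (z i) (z (1 + i)) (z (2 + i))
                      → Spans g (z (1 + i)) (z (2 + i)) (z (3 + i)) → f ≢ g)

  -- Two sequences represent the same zigzag (same cyclic sequence)
  SameZ : (ℕ → Fin n) → (ℕ → Fin n) → Set
  SameZ z w = ∃[ s ] (∀ i → w i ≡ z (s + i))

  -- z ∈ 𝒵(F): z contains consecutive oriented edges e, D_F(e) for some
  -- e ∈ Ω(F), i.e. three consecutive vertices forming F in some order
  InZ : Fin m → (ℕ → Fin n) → Set
  InZ F z = ∃[ i ] Spans F (z i) (z (1 + i)) (z (2 + i))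

  -- |𝒵(F)| = 2
  LocallyZKnotted : Fin m → Set
  LocallyZKnotted F =
    Σ (ℕ → Fin n) λ z₁ → Σ (ℕ → Fin n) λ z₂ →
      (Zigzag z₁ × InZ F z₁) × (Zigzag z₂ × InZ F z₂) × ¬ SameZ z₁ z₂
      × (∀ w → Zigzag w → InZ F w → SameZ z₁ w ⊎ SameZ z₂ w)

  IsPeriod : (ℕ → Fin n) → ℕ → Set
  IsPeriod z p = 0 < p × (∀ i → z (p + i) ≡ z i)

  MinimalPeriod : (ℕ → Fin n) → ℕ → Set
  MinimalPeriod z p = IsPeriod z p × (∀ q → IsPeriod z q → p ≤ q)

  OnEdge : (ℕ → Fin n) → Fin n → Fin n → ℕ → Set
  OnEdge z u v i = (z i ≡ u × z (suc i) ≡ v) ⊎ (z i ≡ v × z (suc i) ≡ u)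

  onEdge? : ∀ z u v i → Dec (OnEdge z u v i)
  onEdge? z u v i = ((z i ≟ᶠ u) ×-dec (z (suc i) ≟ᶠ v)) ⊎-dec ((z i ≟ᶠ v) ×-dec (z (suc i) ≟ᶠ u))

  passages : (ℕ → Fin n) → Fin n → Fin n → ℕ → ℕ
  passages z u v p = length (filter (onEdge? z u v) (upTo p))

  PassesTwice : (ℕ → Fin n) → Fin n → Fin n → Set
  PassesTwice z u v = ∃[ p ] (MinimalPeriod z p × passages z u v p ≡ 2)

module Submission where

-- A zigzag is its vertex sequence; three consecutive vertices form a triple.
-- A zigzag is determined by any of its triples, forwards and backwards (the
-- next vertex is the third vertex of the other face through the last edge).
-- Hence zigzags sharing a triple coincide up to shift, no zigzag contains a
-- triple together with its reverse, zigzags are periodic, and a triple occurs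
-- at most once per minimal period.  Say z covers F if for every ordering a b c
-- of the vertices of F, z contains a b c or c b a.  Every passage of z through
-- an edge of F is flanked by F, which gives: z passes twice through each edge
-- of F iff z covers F (EdgeOfFace).  A covering zigzag and its reverse are the
-- only classes in 𝒵(F) (covers⇒knotted); conversely, with only two classes,
-- every zigzag of 𝒵(F) covers F (knotted⇒covers).

open import Defs
open import Data.Nat using (ℕ; zero; suc; _+_; _*_; _∸_; _≤_; _<_; s≤s; _<?_; NonZero; >-nonZero)
open import Data.Nat.Properties
open import Data.Nat.DivMod using (_%_; _/_; m%n<n; m≡m%n+[m/n]*n)
open import Data.Fin using (Fin; toℕ; combine; fromℕ<) renaming (_≟_ to _≟ᶠ_)
open import Data.Fin.Properties using (all?; any?; pigeonhole; combine-injective; toℕ-fromℕ<)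
open import Data.Product using (Σ; ∃-syntax; _×_; _,_; proj₁; proj₂)
open import Data.Product.Properties using (≡-dec)
open import Data.Sum using (_⊎_; inj₁; inj₂; swap)
open import Data.Empty using (⊥; ⊥-elim)
open import Data.List using (length; filter; upTo; [_]; _++_)
open import Data.List.Properties using (filter-++; length-++; upTo-∷ʳ; filter-accept; filter-reject)
open import Function using (_∘_)
open import Level using (0ℓ)
open import Relation.Binary.PropositionalEquality
  using (_≡_; _≢_; refl; sym; trans; cong; subst; module ≡-Reasoning)
open import Relation.Binary.Definitions using (DecidableEquality; tri<; tri≈; tri>)
open import Relation.Nullary using (¬_; Dec; yes; no)
open import Relation.Nullary.Decidable using (toWitness; ¬?; _→-dec_; _⊎-dec_; _×-dec_)
open import Relation.Unary using (Pred; Decidable)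

-- Two facts about Fin 3, checked by exhaustive enumeration.  They are kept
-- abstract so that later proofs never unfold the enumeration.
abstract
  Fin3-exhaust : ∀ (a b c d : Fin 3) → a ≢ b → b ≢ c → a ≢ c → d ≡ a ⊎ d ≡ b ⊎ d ≡ c
  Fin3-exhaust = toWitness {a? = all? λ a → all? λ b → all? λ c → all? λ d →
    ¬? (a ≟ᶠ b) →-dec ¬? (b ≟ᶠ c) →-dec ¬? (a ≟ᶠ c) →-dec (d ≟ᶠ a ⊎-dec d ≟ᶠ b ⊎-dec d ≟ᶠ c)} _

  Fin3-third : ∀ (a b : Fin 3) → a ≢ b → ∃[ c ] (c ≢ a × c ≢ b)
  Fin3-third = toWitness {a? = all? λ a → all? λ b →
    ¬? (a ≟ᶠ b) →-dec any? λ c → ¬? (c ≟ᶠ a) ×-dec ¬? (c ≟ᶠ b)} _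

module _ {Q : ℕ → Set} (Q? : ∀ k → Dec (Q k)) where
  Least : Set
  Least = ∃[ q ] (Q q × (∀ r → Q r → q ≤ r))

  search-below : ∀ N → (∀ r → r < N → ¬ Q r) ⊎ Least
  search-below zero = inj₁ (λ _ ())
  search-below (suc N) with search-below N
  ... | inj₂ found = inj₂ found
  ... | inj₁ none with Q? N
  ...   | yes QN = inj₂ (N , QN , λ r Qr → ≮⇒≥ (λ r<N → none r r<N Qr))
  ...   | no ¬QN = inj₁ none-below-suc
    where
    none-below-suc : ∀ r → r < suc N → ¬ Q r
    none-below-suc r r<1+N with m<1+n⇒m<n∨m≡n r<1+N
    ... | inj₁ r<N  = none r r<N
    ... | inj₂ refl = ¬QN

  least : ∀ N → Q N → Least
  least N QN with search-below (suc N)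
  ... | inj₁ none  = ⊥-elim (none N ≤-refl QN)
  ... | inj₂ found = found

-- Counting the indices below p that satisfy a decidable predicate,
-- the shape of  passages  in the statement.
module Count {P : Pred ℕ 0ℓ} (P? : Decidable P) where
  open ≡-Reasoning

  count : ℕ → ℕ
  count p = length (filter P? (upTo p))

  count-suc : ∀ p → count (suc p) ≡ count p + length (filter P? [ p ])
  count-suc p = begin
    length (filter P? (upTo (suc p)))              ≡⟨ cong (length ∘ filter P?) (sym (upTo-∷ʳ p)) ⟩
    length (filter P? (upTo p ++ [ p ]))           ≡⟨ cong length (filter-++ P? (upTo p) [ p ]) ⟩
    length (filter P? (upTo p) ++ filter P? [ p ]) ≡⟨ length-++ (filter P? (upTo p)) ⟩
    count p + length (filter P? [ p ])             ∎

  count-yes : ∀ {p} → P p → count (suc p) ≡ suc (count p)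
  count-yes {p} Pp = begin
    count (suc p)                          ≡⟨ count-suc p ⟩
    count p + length (filter P? [ p ])     ≡⟨ cong (λ l → count p + length l) (filter-accept P? Pp) ⟩
    count p + 1                            ≡⟨ +-comm (count p) 1 ⟩
    suc (count p)                          ∎

  count-no : ∀ {p} → ¬ P p → count (suc p) ≡ count p
  count-no {p} ¬Pp = begin
    count (suc p)                          ≡⟨ count-suc p ⟩
    count p + length (filter P? [ p ])     ≡⟨ cong (λ l → count p + length l) (filter-reject P? ¬Pp) ⟩
    count p + 0                            ≡⟨ +-identityʳ (count p) ⟩
    count p                                ∎

  count-none : ∀ p → (∀ k → k < p → ¬ P k) → count p ≡ 0
  count-none zero    _    = refl
  count-none (suc p) none = trans (count-no (none p ≤-refl)) (count-none p (λ k k<p → none k (m<n⇒m<1+n k<p)))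

  count-one : ∀ p {i} → i < p → P i → (∀ k → k < p → P k → k ≡ i) → count p ≡ 1
  count-one (suc p) {i} (s≤s i≤p) Pi only with m≤n⇒m<n∨m≡n i≤p
  ... | inj₂ refl = trans (count-yes Pi)
                      (cong suc (count-none p (λ k k<p Pk → <-irrefl (only k (m<n⇒m<1+n k<p) Pk) k<p)))
  ... | inj₁ i<p with P? p
  ...   | yes Pp = ⊥-elim (<-irrefl (sym (only p ≤-refl Pp)) i<p)
  ...   | no ¬Pp = trans (count-no ¬Pp) (count-one p i<p Pi (λ k k<p → only k (m<n⇒m<1+n k<p)))

  count-two : ∀ p {i j} → i < j → j < p → P i → P j → (∀ k → k < p → P k → k ≡ i ⊎ k ≡ j) → count p ≡ 2
  count-two (suc p) {i} {j} i<j (s≤s j≤p) Pi Pj only with m≤n⇒m<n∨m≡n j≤p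
  ... | inj₂ refl = trans (count-yes Pj) (cong suc (count-one p i<j Pi only-i))
    where
    only-i : ∀ k → k < j → P k → k ≡ i
    only-i k k<j Pk with only k (m<n⇒m<1+n k<j) Pk
    ... | inj₁ k≡i = k≡i
    ... | inj₂ k≡j = ⊥-elim (<-irrefl k≡j k<j)
  ... | inj₁ j<p with P? p
  ...   | no ¬Pp = trans (count-no ¬Pp) (count-two p i<j j<p Pi Pj (λ k k<p → only k (m<n⇒m<1+n k<p)))
  ...   | yes Pp with only p ≤-refl Pp
  ...     | inj₁ refl = ⊥-elim (<-irrefl refl (<-trans i<j j<p))
  ...     | inj₂ refl = ⊥-elim (<-irrefl refl j<p)

  count-exactly-two : ∀ p {i j} → i ≢ j → i < p → j < p → P i → P j
                    → (∀ k → k < p → P k → k ≡ i ⊎ k ≡ j) → count p ≡ 2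
  count-exactly-two p {i} {j} i≢j i<p j<p Pi Pj only with <-cmp i j
  ... | tri< i<j _ _ = count-two p i<j j<p Pi Pj only
  ... | tri≈ _ i≡j _ = ⊥-elim (i≢j i≡j)
  ... | tri> _ _ j<i = count-two p j<i i<p Pj Pi (λ k k<p Pk → swap (only k k<p Pk))

  count-witness : ∀ p {c} → count p ≡ suc c → ∃[ i ] (i < p × P i)
  count-witness zero    ()
  count-witness (suc p) e with P? p
  ... | yes Pp = p , ≤-refl , Pp
  ... | no ¬Pp with count-witness p (trans (sym (count-no ¬Pp)) e)
  ...   | i , i<p , Pi = i , m<n⇒m<1+n i<p , Pi

  count-two-witnesses : ∀ p {c} → count p ≡ suc (suc c) → ∃[ i ] ∃[ j ] (i < j × j < p × P i × P j)
  count-two-witnesses zero    ()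
  count-two-witnesses (suc p) e with P? p
  ... | yes Pp with count-witness p (suc-injective (trans (sym (count-yes Pp)) e))
  ...   | i , i<p , Pi = i , p , i<p , ≤-refl , Pi , Pp
  count-two-witnesses (suc p) e | no ¬Pp with count-two-witnesses p (trans (sym (count-no ¬Pp)) e)
  ...   | i , j , i<j , j<p , Pi , Pj = i , j , i<j , m<n⇒m<1+n j<p , Pi , Pj

module _ (T : Triangulation) where
  open Triangulation T

  Vertex : Set
  Vertex = Fin n

  Inc : Fin m → Vertex → Set
  Inc = InFace corner

  inc₁ : ∀ {f x y w} → Spans T f x y w → Inc f x
  inc₁ (_ , fx , _ , _) = fx

  inc₂ : ∀ {f x y w} → Spans T f x y w → Inc f y
  inc₂ (_ , _ , fy , _) = fy

  inc₃ : ∀ {f x y w} → Spans T f x y w → Inc f w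
  inc₃ (_ , _ , _ , fw) = fw

  spans-cong : ∀ {f x y w x′ y′ w′} → x ≡ x′ → y ≡ y′ → w ≡ w′ → Spans T f x y w → Spans T f x′ y′ w′
  spans-cong refl refl refl sp = sp

  spans-face : ∀ {f g x y w} → f ≡ g → Spans T f x y w → Spans T g x y w
  spans-face refl sp = sp

  spans-rotate : ∀ {f x y w} → Spans T f x y w → Spans T f y w x
  spans-rotate ((x≢y , y≢w , x≢w) , fx , fy , fw) = (y≢w , x≢w ∘ sym , x≢y ∘ sym) , fy , fw , fx

  spans-swap : ∀ {f x y w} → Spans T f x y w → Spans T f y x w
  spans-swap ((x≢y , y≢w , x≢w) , fx , fy , fw) = (x≢y ∘ sym , x≢w , y≢w) , fy , fx , fw

  spans-reverse : ∀ {f x y w} → Spans T f x y w → Spans T f w y x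
  spans-reverse sp = spans-swap (spans-rotate sp)

  corner-≡ : ∀ {f j k x y} → corner f j ≡ x → corner f k ≡ y → j ≡ k → x ≡ y
  corner-≡ ex ey refl = trans (sym ex) ey

  spans-vertices : ∀ {f x y w v} → Spans T f x y w → Inc f v → v ≡ x ⊎ v ≡ y ⊎ v ≡ w
  spans-vertices ((x≢y , y≢w , x≢w) , (jx , ex) , (jy , ey) , (jw , ew)) (jv , ev)
    with Fin3-exhaust jx jy jw jv (x≢y ∘ corner-≡ ex ey) (y≢w ∘ corner-≡ ey ew) (x≢w ∘ corner-≡ ex ew)
  ... | inj₁ e         = inj₁ (corner-≡ ev ex e)
  ... | inj₂ (inj₁ e)  = inj₂ (inj₁ (corner-≡ ev ey e))
  ... | inj₂ (inj₂ e)  = inj₂ (inj₂ (corner-≡ ev ew e))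

  third-unique : ∀ {f x y w w′} → Spans T f x y w → Spans T f x y w′ → w ≡ w′
  third-unique sp ((_ , y≢w′ , x≢w′) , _ , _ , fw′) with spans-vertices sp fw′
  ... | inj₁ w′≡x        = ⊥-elim (x≢w′ (sym w′≡x))
  ... | inj₂ (inj₁ w′≡y) = ⊥-elim (y≢w′ (sym w′≡y))
  ... | inj₂ (inj₂ w′≡w) = sym w′≡w

  face-unique : ∀ {f g x y w} → Spans T f x y w → Spans T g x y w → f ≡ g
  face-unique {f} {g} {x} {y} {w} sf sg with f ≟ᶠ g
  ... | yes f≡g = f≡g
  ... | no f≢g  = ⊥-elim (faces-distinct f g f≢g (λ v fv → inc-g (spans-vertices sf fv)))
    where
    inc-g : ∀ {v} → v ≡ x ⊎ v ≡ y ⊎ v ≡ w → Inc g v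
    inc-g (inj₁ refl)        = inc₁ sg
    inc-g (inj₂ (inj₁ refl)) = inc₂ sg
    inc-g (inj₂ (inj₂ refl)) = inc₃ sg

  edge-in-two-faces : ∀ {x y A B C} → x ≢ y → Inc A x → Inc A y → Inc B x → Inc B y → Inc C x → Inc C y
                    → A ≢ B → C ≡ A ⊎ C ≡ B
  edge-in-two-faces {x} {y} {A} {B} {C} x≢y Ax Ay Bx By Cx Cy A≢B with two-faces x y (x≢y , A , Ax , Ay)
  ... | _ , _ , _ , _ , _ , only with only A Ax Ay | only B Bx By | only C Cx Cy
  ... | inj₁ refl | inj₁ refl | _         = ⊥-elim (A≢B refl)
  ... | inj₂ refl | inj₂ refl | _         = ⊥-elim (A≢B refl)
  ... | inj₁ refl | inj₂ refl | inj₁ refl = inj₁ refl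
  ... | inj₁ refl | inj₂ refl | inj₂ refl = inj₂ refl
  ... | inj₂ refl | inj₁ refl | inj₁ refl = inj₂ refl
  ... | inj₂ refl | inj₁ refl | inj₂ refl = inj₁ refl

  -- Across the edge q r of a face f = p q r lies a single other face, so its
  -- vertex opposite to q r is unique.
  opposite-unique : ∀ {f g g′ p q r s s′} → Spans T f p q r → Spans T g q r s → f ≢ g
                  → Spans T g′ q r s′ → f ≢ g′ → s ≡ s′
  opposite-unique sf sg@((q≢r , _ , _) , _) f≢g sg′ f≢g′
    with edge-in-two-faces q≢r (inc₂ sf) (inc₃ sf) (inc₁ sg) (inc₂ sg) (inc₁ sg′) (inc₂ sg′) f≢g
  ... | inj₁ g′≡f = ⊥-elim (f≢g′ (sym g′≡f))
  ... | inj₂ g′≡g = third-unique sg (spans-face g′≡g sg′)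

  corners-span : ∀ f j k → j ≢ k → ∃[ l ] Spans T f (corner f j) (corner f k) (corner f l)
  corners-span f j k j≢k with Fin3-third j k j≢k
  ... | l , l≢j , l≢k = l , (j≢k ∘ corner-inj f , l≢k ∘ sym ∘ corner-inj f , l≢j ∘ sym ∘ corner-inj f)
                          , (j , refl) , (k , refl) , (l , refl)

  complete-span : ∀ {g y w} → y ≢ w → Inc g y → Inc g w → ∃[ v ] Spans T g y w v
  complete-span {g} y≢w (jy , refl) (jw , refl) with corners-span g jy jw (y≢w ∘ cong (corner g))
  ... | l , sp = corner g l , sp

  other-face : ∀ {f y w} → y ≢ w → Inc f y → Inc f w → ∃[ g ] (g ≢ f × Inc g y × Inc g w)
  other-face {f} {y} {w} y≢w fy fw with two-faces y w (y≢w , f , fy , fw)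
  ... | g₁ , g₂ , g₁≢g₂ , (g₁y , g₁w) , (g₂y , g₂w) , _ with f ≟ᶠ g₁
  ... | yes refl = g₂ , g₁≢g₂ ∘ sym , g₂y , g₂w
  ... | no f≢g₁  = g₁ , f≢g₁ ∘ sym , g₁y , g₁w

  Triple : Set
  Triple = Vertex × Vertex × Vertex

  triple : (ℕ → Vertex) → ℕ → Triple
  triple z i = z i , z (suc i) , z (suc (suc i))

  reverse : Triple → Triple
  reverse (a , b , c) = c , b , a

  triple-≡ : ∀ {a b c a′ b′ c′} → a ≡ a′ → b ≡ b′ → c ≡ c′ → _≡_ {A = Triple} (a , b , c) (a′ , b′ , c′)
  triple-≡ refl refl refl = refl

  fst≡ : ∀ {a b c a′ b′ c′} → _≡_ {A = Triple} (a , b , c) (a′ , b′ , c′) → a ≡ a′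
  fst≡ refl = refl

  mid≡ : ∀ {a b c a′ b′ c′} → _≡_ {A = Triple} (a , b , c) (a′ , b′ , c′) → b ≡ b′
  mid≡ refl = refl

  lst≡ : ∀ {a b c a′ b′ c′} → _≡_ {A = Triple} (a , b , c) (a′ , b′ , c′) → c ≡ c′
  lst≡ refl = refl

  reverse-injective : ∀ {t t′} → reverse t ≡ reverse t′ → t ≡ t′
  reverse-injective {_ , _ , _} {_ , _ , _} refl = refl

  spans-≡ : ∀ {f a b c a′ b′ c′} → _≡_ {A = Triple} (a , b , c) (a′ , b′ , c′) → Spans T f a b c → Spans T f a′ b′ c′
  spans-≡ refl sp = sp

  _≟₃_ : DecidableEquality Triple
  _≟₃_ = ≡-dec _≟ᶠ_ (≡-dec _≟ᶠ_ _≟ᶠ_)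

  module _ {z} (Zz : Zigzag T z) where
    face-at : ℕ → Fin m
    face-at i = proj₁ (proj₁ Zz i)

    face-at-spans : ∀ i → Spans T (face-at i) (z i) (z (suc i)) (z (suc (suc i)))
    face-at-spans i = proj₂ (proj₁ Zz i)

    faces-differ : ∀ i → face-at i ≢ face-at (suc i)
    faces-differ i = proj₂ Zz i _ _ (face-at-spans i) (face-at-spans (suc i))

  -- A zigzag is determined by one triple: one step forwards, one step
  -- backwards, and one step along a reversed zigzag.
  module _ {z w} (Zz : Zigzag T z) (Zw : Zigzag T w) where
    step-forward : ∀ {a b} → triple z a ≡ triple w b → triple z (suc a) ≡ triple w (suc b)
    step-forward {a} {b} e = triple-≡ (mid≡ e) (lst≡ e) next
      where
      same-face : face-at Zw b ≡ face-at Zz a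
      same-face = face-unique (spans-≡ (sym e) (face-at-spans Zw b)) (face-at-spans Zz a)
      next : z (3 + a) ≡ w (3 + b)
      next = opposite-unique (face-at-spans Zz a) (face-at-spans Zz (suc a)) (faces-differ Zz a)
               (spans-cong (sym (mid≡ e)) (sym (lst≡ e)) refl (face-at-spans Zw (suc b)))
               (λ h → faces-differ Zw b (trans same-face h))

    step-backward : ∀ {a b} → triple z (suc a) ≡ triple w (suc b) → triple z a ≡ triple w b
    step-backward {a} {b} e = triple-≡ previous (fst≡ e) (mid≡ e)
      where
      same-face : face-at Zw (suc b) ≡ face-at Zz (suc a)
      same-face = face-unique (spans-≡ (sym e) (face-at-spans Zw (suc b))) (face-at-spans Zz (suc a))
      previous : z a ≡ w b
      previous = opposite-unique (spans-rotate (spans-rotate (face-at-spans Zz (suc a))))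
                   (spans-rotate (face-at-spans Zz a)) (faces-differ Zz a ∘ sym)
                   (spans-cong (sym (fst≡ e)) (sym (mid≡ e)) refl (spans-rotate (face-at-spans Zw b)))
                   (λ h → faces-differ Zw b (trans (sym h) (sym same-face)))

    step-reverse : ∀ {a b} → triple z (suc a) ≡ reverse (triple w b) → triple z a ≡ reverse (triple w (suc b))
    step-reverse {a} {b} e = triple-≡ previous (fst≡ e) (mid≡ e)
      where
      same-face : face-at Zw b ≡ face-at Zz (suc a)
      same-face = face-unique (spans-≡ (sym e) (spans-reverse (face-at-spans Zw b))) (face-at-spans Zz (suc a))
      previous : z a ≡ w (3 + b)
      previous = opposite-unique (spans-rotate (spans-rotate (face-at-spans Zz (suc a))))
                   (spans-rotate (face-at-spans Zz a)) (faces-differ Zz a ∘ sym)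
                   (spans-cong (sym (fst≡ e)) (sym (mid≡ e)) refl (spans-swap (face-at-spans Zw (suc b))))
                   (λ h → faces-differ Zw b (trans same-face h))

    shift-forward : ∀ k {a b} → triple z a ≡ triple w b → triple z (k + a) ≡ triple w (k + b)
    shift-forward zero    e = e
    shift-forward (suc k) e = step-forward (shift-forward k e)

    shift-backward : ∀ k {a b} → triple z (k + a) ≡ triple w (k + b) → triple z a ≡ triple w b
    shift-backward zero    e = e
    shift-backward (suc k) e = shift-backward k (step-backward e)

    shift-reverse : ∀ k {a b} → triple z (k + a) ≡ reverse (triple w b) → triple z a ≡ reverse (triple w (k + b))
    shift-reverse zero            e = e
    shift-reverse (suc k) {a} {b} e =
      subst (λ i → triple z a ≡ reverse (triple w i)) (+-suc k b) (shift-reverse k (step-reverse e))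

  -- A zigzag never meets its own reverse g steps ahead: stepping back on both
  -- sides reduces g by two, down to a coincidence of two vertices of a face.
  no-reverse-ahead : ∀ {z} → Zigzag T z → ∀ g b → triple z (g + b) ≢ reverse (triple z b)
  no-reverse-ahead Zz zero b e with face-at-spans Zz b
  ... | (_ , _ , x≢w) , _ = x≢w (fst≡ e)
  no-reverse-ahead Zz (suc zero) b e with face-at-spans Zz b
  ... | (_ , y≢w , _) , _ = y≢w (fst≡ e)
  no-reverse-ahead {z} Zz (suc (suc g)) b e = no-reverse-ahead Zz g (suc b)
    (subst (λ i → triple z i ≡ reverse (triple z (suc b))) (sym (+-suc g b)) (step-reverse Zz Zz e))

  module Periodic {z : ℕ → Vertex} {p} (Pz : IsPeriod T z p) where
    open ≡-Reasoning

    period-suc : ∀ r → z (suc (p + r)) ≡ z (suc r)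
    period-suc r = trans (cong z (sym (+-suc p r))) (proj₂ Pz (suc r))

    triple-period : ∀ r → triple z (p + r) ≡ triple z r
    triple-period r = triple-≡ (proj₂ Pz r) (period-suc r)
                        (trans (cong (z ∘ suc) (sym (+-suc p r))) (period-suc (suc r)))

    triple-periods : ∀ k r → triple z (k * p + r) ≡ triple z r
    triple-periods zero    r = refl
    triple-periods (suc k) r = begin
      triple z (p + k * p + r)   ≡⟨ cong (triple z) (+-assoc p (k * p) r) ⟩
      triple z (p + (k * p + r)) ≡⟨ triple-period (k * p + r) ⟩
      triple z (k * p + r)       ≡⟨ triple-periods k r ⟩
      triple z r                 ∎

    -- a period is positive, which the division by p below needs
    instance
      period-nonZero : NonZero p
      period-nonZero = >-nonZero (proj₁ Pz)

    reoccurs-after : ∀ a b → ∃[ a′ ] (b ≤ a′ × triple z a′ ≡ triple z a)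
    reoccurs-after a b = b * p + a , ≤-trans (m≤m*n b p) (m≤m+n (b * p) a) , triple-periods b a

    triple-mod : ∀ s → triple z (s % p) ≡ triple z s
    triple-mod s = sym (begin
      triple z s                   ≡⟨ cong (triple z) (m≡m%n+[m/n]*n s p) ⟩
      triple z (s % p + s / p * p) ≡⟨ cong (triple z) (+-comm (s % p) (s / p * p)) ⟩
      triple z (s / p * p + s % p) ≡⟨ triple-periods (s / p) (s % p) ⟩
      triple z (s % p)             ∎)

  period-from-repeat : ∀ {z a b} → Zigzag T z → a < b → triple z a ≡ triple z b → IsPeriod T z (b ∸ a)
  period-from-repeat {z} {a} {b} Zz a<b e = m<n⇒0<n∸m a<b , λ i → begin
      z (b ∸ a + i)   ≡⟨ cong z (+-comm (b ∸ a) i) ⟩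
      z (i + (b ∸ a)) ≡⟨ sym (fst≡ (shift-forward Zz Zz i from-start)) ⟩
      z (i + 0)       ≡⟨ cong z (+-identityʳ i) ⟩
      z i             ∎
    where
    open ≡-Reasoning
    from-start : triple z 0 ≡ triple z (b ∸ a)
    from-start = shift-backward Zz Zz a
      (trans (cong (triple z) (+-identityʳ a)) (trans e (cong (triple z) (sym (m+[n∸m]≡n (<⇒≤ a<b))))))

  -- Every zigzag is periodic: two of its first n³ + 1 triples coincide.
  period-exists : ∀ {z} → Zigzag T z → ∃[ p ] IsPeriod T z p
  period-exists {z} Zz with pigeonhole (n<1+n (n * (n * n))) (λ i → code (triple z (toℕ i)))
    where
    code : Triple → Fin (n * (n * n))
    code (a , b , c) = combine a (combine b c)
  ... | i , j , i<j , e with combine-injective _ _ _ _ e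
  ...   | a≡ , bc≡ with combine-injective _ _ _ _ bc≡
  ...     | b≡ , c≡ = _ , period-from-repeat Zz i<j (triple-≡ a≡ b≡ c≡)

  -- For a zigzag, q is a period iff q > 0 and the triple at q repeats the first one.
  Returns : (ℕ → Vertex) → ℕ → Set
  Returns z q = 0 < q × triple z q ≡ triple z 0

  returns? : ∀ z q → Dec (Returns z q)
  returns? z q = (0 <? q) ×-dec (triple z q ≟₃ triple z 0)

  period⇒returns : ∀ {z q} → IsPeriod T z q → Returns z q
  period⇒returns {z} {q} Pq = proj₁ Pq , trans (cong (triple z) (sym (+-identityʳ q))) (Periodic.triple-period Pq 0)

  -- Every zigzag has a minimal period, the least q that returns.  Abstract:
  -- only its type is used, and unfolding the search under `with` is costly.
  abstract
    minimal-period-exists : ∀ {z} → Zigzag T z → ∃[ p ] MinimalPeriod T z p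
    minimal-period-exists {z} Zz with period-exists Zz
    ... | p , Pp with least (returns? z) p (period⇒returns Pp)
    ...   | q , (0<q , e) , minimal = q , period-from-repeat Zz 0<q (sym e) , λ r Pr → minimal r (period⇒returns Pr)

  minimal-period-unique : ∀ {z p i j} → Zigzag T z → MinimalPeriod T z p → i < p → j < p
                        → triple z i ≡ triple z j → i ≡ j
  minimal-period-unique {z} {p} {i} {j} Zz (_ , minimal) i<p j<p e with <-cmp i j
  ... | tri≈ _ i≡j _ = i≡j
  ... | tri< i<j _ _ = ⊥-elim (<⇒≱ (≤-<-trans (m∸n≤m j i) j<p) (minimal _ (period-from-repeat Zz i<j e)))
  ... | tri> _ _ j<i = ⊥-elim (<⇒≱ (≤-<-trans (m∸n≤m i j) i<p) (minimal _ (period-from-repeat Zz j<i (sym e))))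

  -- A zigzag never meets its own reverse (shift the first position past the second).
  no-reverse : ∀ {z a b} → Zigzag T z → triple z a ≢ reverse (triple z b)
  no-reverse {z} {a} {b} Zz e with period-exists Zz
  ... | p , Pp with Periodic.reoccurs-after Pp a b
  ...   | a′ , b≤a′ , e′ = no-reverse-ahead Zz (a′ ∸ b) b (trans (cong (triple z) (m∸n+n≡m b≤a′)) (trans e′ e))

  Occurs : (ℕ → Vertex) → Triple → Set
  Occurs z t = ∃[ i ] triple z i ≡ t

  Meets : (ℕ → Vertex) → Triple → Set
  Meets z t = Occurs z t ⊎ Occurs z (reverse t)

  not-both : ∀ {z x y w} → Zigzag T z → Occurs z (x , y , w) → Occurs z (w , y , x) → ⊥
  not-both Zz (a , ea) (b , eb) = no-reverse Zz (trans ea (sym (cong reverse eb)))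

  occurs-in-window : ∀ {z p t} → Zigzag T z → IsPeriod T z p → ∀ k → Occurs z t
                   → ∃[ i ] (i < p × triple z (k + i) ≡ t)
  occurs-in-window {z} {p} {t} Zz Pp k (s , e) with Periodic.reoccurs-after Pp s k
  ... | s′ , k≤s′ , e′ = (s′ ∸ k) % p , m%n<n (s′ ∸ k) p , (begin
      triple z (k + (s′ ∸ k) % p) ≡⟨ shift-forward Zz Zz k (Periodic.triple-mod Pp (s′ ∸ k)) ⟩
      triple z (k + (s′ ∸ k))     ≡⟨ cong (triple z) (m+[n∸m]≡n k≤s′) ⟩
      triple z s′                 ≡⟨ e′ ⟩
      triple z s                  ≡⟨ e ⟩
      t                           ∎)
    where
    open ≡-Reasoning
    open Periodic Pp using (period-nonZero)

  -- occurrence is decidable: search one period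
  occurs? : ∀ {z} → Zigzag T z → ∀ t → Dec (Occurs z t)
  occurs? {z} Zz t with period-exists Zz
  ... | p , Pp with any? (λ (i : Fin p) → triple z (toℕ i) ≟₃ t)
  ...   | yes (i , e) = yes (toℕ i , e)
  ...   | no none = no λ o → let (i , i<p , e) = occurs-in-window Zz Pp 0 o in
                     none (fromℕ< i<p , trans (cong (triple z) (toℕ-fromℕ< i<p)) e)

  triple-shift : ∀ {z w s} → (∀ i → w i ≡ z (s + i)) → ∀ i → triple w i ≡ triple z (s + i)
  triple-shift {z} {w} {s} e i = triple-≡ (e i) (trans (e (suc i)) (cong z (+-suc s i)))
    (trans (e (suc (suc i))) (cong z (trans (+-suc s (suc i)) (cong suc (+-suc s i)))))

  same-occurs⁻ : ∀ {z w t} → SameZ T z w → Occurs w t → Occurs z t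
  same-occurs⁻ {z} {w} (s , e) (i , ei) = s + i , trans (sym (triple-shift {z} {w} {s} e i)) ei

  same-occurs : ∀ {z w t} → Zigzag T z → SameZ T z w → Occurs z t → Occurs w t
  same-occurs {z} {w} Zz (s , e) (a , ea) with period-exists Zz
  ... | p , Pp with Periodic.reoccurs-after Pp a s
  ...   | a′ , s≤a′ , ea′ = a′ ∸ s , trans (triple-shift {z} {w} {s} e (a′ ∸ s))
                               (trans (cong (triple z) (m+[n∸m]≡n s≤a′)) (trans ea′ ea))

  same-class-occurs : ∀ {z v v′ t} → Zigzag T z → SameZ T z v → SameZ T z v′ → Occurs v t → Occurs v′ t
  same-class-occurs Zz zv zv′ o = same-occurs Zz zv′ (same-occurs⁻ zv o)

  same-from-shared-triple : ∀ {z w i s} → Zigzag T z → Zigzag T w → triple w i ≡ triple z s → SameZ T z w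
  same-from-shared-triple {z} {w} {i} {s} Zz Zw e with period-exists Zz
  ... | p , Pp with Periodic.reoccurs-after Pp s i
  ...   | s′ , i≤s′ , es′ = s′ ∸ i , λ k → begin
      w k                 ≡⟨ cong w (sym (+-identityʳ k)) ⟩
      w (k + 0)           ≡⟨ fst≡ (shift-forward Zw Zz k aligned) ⟩
      z (k + (s′ ∸ i))    ≡⟨ cong z (+-comm k (s′ ∸ i)) ⟩
      z (s′ ∸ i + k)      ∎
    where
    open ≡-Reasoning
    aligned : triple w 0 ≡ triple z (s′ ∸ i)
    aligned = shift-backward Zw Zz i
      (trans (cong (triple w) (+-identityʳ i)) (trans e (trans (sym es′) (cong (triple z) (sym (m+[n∸m]≡n i≤s′))))))

  reverse-occurs : ∀ {z u i j t} → Zigzag T z → Zigzag T u → triple z i ≡ reverse (triple u j)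
                 → Occurs z (reverse t) → Occurs u t
  reverse-occurs {z} {u} {i} {j} Zz Zu e (s , es) with period-exists Zz
  ... | p , Pp with Periodic.reoccurs-after Pp i s
  ...   | i′ , s≤i′ , ei′ = i′ ∸ s + j , sym (reverse-injective (trans (sym es) (shift-reverse Zz Zu (i′ ∸ s) moved)))
    where
    moved : triple z (i′ ∸ s + s) ≡ reverse (triple u j)
    moved = trans (cong (triple z) (m∸n+n≡m s≤i′)) (trans ei′ e)

  -- A zigzag through any ordering x y w of the vertices of a face: repeatedly
  -- pass to the other face through the last edge and append its third vertex.

  record Flag : Set where
    constructor flag
    field
      x y w : Vertex
      face  : Fin m
      spans : Spans T face x y w

  next-face : (s : Flag) → ∃[ g ] (g ≢ Flag.face s × ∃[ v ] Spans T g (Flag.y s) (Flag.w s) v)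
  next-face (flag _ _ _ _ sp@((_ , y≢w , _) , _)) with other-face y≢w (inc₂ sp) (inc₃ sp)
  ... | g , g≢f , gy , gw = g , g≢f , complete-span y≢w gy gw

  advance : Flag → Flag
  advance s = let (g , _ , v , sg) = next-face s in flag (Flag.y s) (Flag.w s) v g sg

  walk : Flag → ℕ → Flag
  walk s zero    = s
  walk s (suc k) = advance (walk s k)

  zigzag-through : ∀ {f x y w} → Spans T f x y w → Σ (ℕ → Vertex) λ u → Zigzag T u × triple u 0 ≡ (x , y , w)
  zigzag-through {f} {x} {y} {w} sp = u , ((λ i → Flag.face (walk s₀ i) , Flag.spans (walk s₀ i)) , differ) , refl
    where
    s₀ : Flag
    s₀ = flag x y w f sp
    u : ℕ → Vertex
    u k = Flag.x (walk s₀ k)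
    differ : ∀ i g h → Spans T g (u i) (u (1 + i)) (u (2 + i)) → Spans T h (u (1 + i)) (u (2 + i)) (u (3 + i)) → g ≢ h
    differ i g h sg sh g≡h = proj₁ (proj₂ (next-face (walk s₀ i)))
      (trans (sym (face-unique sh (Flag.spans (walk s₀ (suc i)))))
        (trans (sym g≡h) (face-unique sg (Flag.spans (walk s₀ i)))))

  -- Passages through an edge x y of a face F = x y w, counted over a minimal
  -- period suc q; position q + i is, cyclically, the one just before i.
  module EdgeOfFace {z q} (Zz : Zigzag T z) (Mz : MinimalPeriod T z (suc q))
                    {F x y w} (sF : Spans T F x y w) where
    open Count (onEdge? T z x y) using (count-exactly-two; count-two-witnesses)

    Pz : IsPeriod T z (suc q)
    Pz = proj₁ Mz

    triple-before : ∀ i → triple z (q + i) ≡ (z (q + i) , z i , z (suc i))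
    triple-before i = triple-≡ refl (fst≡ (Periodic.triple-period Pz i)) (mid≡ (Periodic.triple-period Pz i))

    face-before : ∀ i → Spans T (face-at Zz (q + i)) (z (q + i)) (z i) (z (suc i))
    face-before i = spans-≡ (triple-before i) (face-at-spans Zz (q + i))

    face-after : ∀ i → Spans T (face-at Zz (suc (q + i))) (z i) (z (suc i)) (z (suc (suc i)))
    face-after i = spans-≡ (Periodic.triple-period Pz i) (face-at-spans Zz (suc (q + i)))

    -- If the i-th edge is the edge a b of F = a b w, then F is the face after
    -- it (z continues a b w) or the face before it (z arrives as w a b).
    flank-face : ∀ {i a b} → Spans T F a b w → z i ≡ a → z (suc i) ≡ b
               → triple z i ≡ (a , b , w) ⊎ triple z (q + i) ≡ (w , a , b)
    flank-face {i} sp@((a≢b , _ , _) , Fa , Fb , _) refl refl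
      with edge-in-two-faces a≢b (inc₂ (face-before i)) (inc₃ (face-before i))
                                 (inc₁ (face-after i)) (inc₂ (face-after i)) Fa Fb (faces-differ Zz (q + i))
    ... | inj₁ F≡before = inj₂ (trans (triple-before i)
            (triple-≡ (third-unique (spans-rotate (face-before i)) (spans-face F≡before sp)) refl refl))
    ... | inj₂ F≡after = inj₁ (triple-≡ refl refl (sym (third-unique sp (spans-face (sym F≡after) (face-after i)))))

    -- passage i through the edge {a,b} is accounted for by the triple a b w
    -- (at i) or by its reverse w b a (just before i)
    Flank : Vertex → Vertex → ℕ → Set
    Flank a b i = triple z i ≡ (a , b , w) ⊎ triple z (q + i) ≡ (w , b , a)

    classify : ∀ {i} → OnEdge T z x y i → Flank x y i ⊎ Flank y x i
    classify (inj₁ (zi≡x , zi′≡y)) with flank-face sF zi≡x zi′≡y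
    ... | inj₁ e = inj₁ (inj₁ e)
    ... | inj₂ e = inj₂ (inj₂ e)
    classify (inj₂ (zi≡y , zi′≡x)) with flank-face (spans-swap sF) zi≡y zi′≡x
    ... | inj₁ e = inj₂ (inj₁ e)
    ... | inj₂ e = inj₁ (inj₂ e)

    flank-passage : ∀ {a b i} → Flank a b i → OnEdge T z a b i
    flank-passage (inj₁ e) = inj₁ (fst≡ e , mid≡ e)
    flank-passage {i = i} (inj₂ e) = let e′ = trans (sym (triple-before i)) e in inj₂ (mid≡ e′ , lst≡ e′)

    flank-meets : ∀ {a b i} → Flank a b i → Meets z (a , b , w)
    flank-meets {i = i} (inj₁ e) = inj₁ (i , e)
    flank-meets {i = i} (inj₂ e) = inj₂ (q + i , e)

    flank-from-meeting : ∀ {a b} → Meets z (a , b , w) → ∃[ i ] (i < suc q × Flank a b i)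
    flank-from-meeting (inj₁ o) = let (i , i<p , e) = occurs-in-window Zz Pz 0 o in i , i<p , inj₁ e
    flank-from-meeting (inj₂ o) = let (i , i<p , e) = occurs-in-window Zz Pz q o in i , i<p , inj₂ e

    flank-unique : ∀ {a b i k} → i < suc q → k < suc q → Flank a b i → Flank a b k → i ≡ k
    flank-unique i<p k<p (inj₁ e) (inj₁ e′) = minimal-period-unique Zz Mz i<p k<p (trans e (sym e′))
    flank-unique i<p k<p (inj₂ e) (inj₂ e′) =
      minimal-period-unique Zz Mz i<p k<p (shift-backward Zz Zz q (trans e (sym e′)))
    flank-unique {i = i} {k} _ _ (inj₁ e) (inj₂ e′) = ⊥-elim (not-both Zz (i , e) (q + k , e′))
    flank-unique {i = i} {k} _ _ (inj₂ e) (inj₁ e′) = ⊥-elim (not-both Zz (k , e′) (q + i , e))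

    not-after-and-before : ∀ {i a b c} → Spans T F a b c → triple z i ≡ (a , b , c) → triple z (q + i) ≡ (c , a , b) → ⊥
    not-after-and-before {i} sp e e′ = faces-differ Zz (q + i) (trans before (sym after))
      where
      before : face-at Zz (q + i) ≡ F
      before = face-unique (spans-≡ e′ (face-at-spans Zz (q + i))) (spans-rotate (spans-rotate sp))
      after : face-at Zz (suc (q + i)) ≡ F
      after = face-unique (spans-≡ (trans (Periodic.triple-period Pz i) e) (face-at-spans Zz (suc (q + i)))) sp

    flank-opposite : ∀ {i} → Flank x y i → Flank y x i → ⊥
    flank-opposite (inj₁ e) (inj₁ e′) = proj₁ (proj₁ sF) (trans (sym (fst≡ e)) (fst≡ e′))
    flank-opposite (inj₂ e) (inj₂ e′) = proj₁ (proj₁ sF) (trans (sym (mid≡ e′)) (mid≡ e))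
    flank-opposite (inj₁ e) (inj₂ e′) = not-after-and-before sF e e′
    flank-opposite (inj₂ e) (inj₁ e′) = not-after-and-before (spans-swap sF) e′ e

    passes-twice : Meets z (x , y , w) → Meets z (y , x , w) → passages T z x y (suc q) ≡ 2
    passes-twice m₁ m₂ with flank-from-meeting m₁ | flank-from-meeting m₂
    ... | i , i<p , fi | j , j<p , fj =
      count-exactly-two (suc q) i≢j i<p j<p (flank-passage fi) (swap (flank-passage fj)) only
      where
      i≢j : i ≢ j
      i≢j refl = flank-opposite fi fj
      only : ∀ k → k < suc q → OnEdge T z x y k → k ≡ i ⊎ k ≡ j
      only k k<p pk with classify pk
      ... | inj₁ fk = inj₁ (flank-unique k<p i<p fk fi)
      ... | inj₂ fk = inj₂ (flank-unique k<p j<p fk fj)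

    meets-of-twice : passages T z x y (suc q) ≡ 2 → Meets z (x , y , w)
    meets-of-twice two with count-two-witnesses (suc q) two
    ... | i , j , i<j , j<p , pi , pj with classify pi | classify pj
    ...   | inj₁ fi | _       = flank-meets fi
    ...   | inj₂ _  | inj₁ fj = flank-meets fj
    ...   | inj₂ fi | inj₂ fj = ⊥-elim (<-irrefl (flank-unique (<-trans i<j j<p) j<p fi fj) i<j)

  Covers : (ℕ → Vertex) → Fin m → Set
  Covers z F = ∀ {a b c} → Spans T F a b c → Meets z (a , b , c)

  covers⇒passes-twice : ∀ {z} F → Zigzag T z → Covers z F
                      → ∀ j k → j ≢ k → PassesTwice T z (corner F j) (corner F k)
  covers⇒passes-twice F Zz cover j k j≢k with minimal-period-exists Zz | corners-span F j k j≢k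
  ... | zero  , (() , _) , _ | _
  ... | suc q , Mz | _ , sp = suc q , Mz , EdgeOfFace.passes-twice Zz Mz sp (cover sp) (cover (spans-swap sp))

  passes-twice⇒covers : ∀ {z} F → Zigzag T z
                      → (∀ j k → j ≢ k → PassesTwice T z (corner F j) (corner F k)) → Covers z F
  passes-twice⇒covers F Zz twice sp@((a≢b , _ , _) , (ja , refl) , (jb , refl) , _)
    with twice ja jb (a≢b ∘ cong (corner F))
  ... | zero  , ((() , _) , _) , _
  ... | suc q , Mz , two = EdgeOfFace.meets-of-twice Zz Mz sp two

  -- If 𝒵(F) has two classes, every zigzag of 𝒵(F) covers F: otherwise it
  -- would lie in a third class, apart from those of the zigzags started at
  -- a b c and at c b a (which differ, as no zigzag contains both).
  knotted⇒covers : ∀ F → LocallyZKnotted T F → ∀ {z} → Zigzag T z → InZ T F z → Covers z F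
  knotted⇒covers F (z₁ , z₂ , (Z₁ , _) , (Z₂ , _) , _ , classes) {z} Zz z∈F {a} {b} {c} sp
    with occurs? Zz (a , b , c) | occurs? Zz (c , b , a)
  ... | yes o   | _       = inj₁ o
  ... | no _    | yes o   = inj₂ o
  ... | no ¬abc | no ¬cba with zigzag-through sp | zigzag-through (spans-reverse sp)
  ...   | u , Zu , eu | u′ , Zu′ , eu′ = ⊥-elim
    (three-classes (classes z Zz z∈F) (classes u Zu (0 , spans-≡ (sym eu) sp))
                   (classes u′ Zu′ (0 , spans-≡ (sym eu′) (spans-reverse sp))))
    where
    Class : (ℕ → Vertex) → Set
    Class v = SameZ T z₁ v ⊎ SameZ T z₂ v
    three-classes : Class z → Class u → Class u′ → ⊥
    three-classes (inj₁ z₁z) (inj₁ z₁u) _           = ¬abc (same-class-occurs Z₁ z₁u z₁z (0 , eu))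
    three-classes (inj₂ z₂z) (inj₂ z₂u) _           = ¬abc (same-class-occurs Z₂ z₂u z₂z (0 , eu))
    three-classes (inj₁ z₁z) (inj₂ _)   (inj₁ z₁u′) = ¬cba (same-class-occurs Z₁ z₁u′ z₁z (0 , eu′))
    three-classes (inj₂ z₂z) (inj₁ _)   (inj₂ z₂u′) = ¬cba (same-class-occurs Z₂ z₂u′ z₂z (0 , eu′))
    three-classes (inj₁ _)   (inj₂ z₂u) (inj₂ z₂u′) = not-both Zu′ (same-class-occurs Z₂ z₂u z₂u′ (0 , eu)) (0 , eu′)
    three-classes (inj₂ _)   (inj₁ z₁u) (inj₁ z₁u′) = not-both Zu′ (same-class-occurs Z₁ z₁u z₁u′ (0 , eu)) (0 , eu′)

  -- A zigzag z containing a b c that covers F, together with the zigzag u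
  -- started at c b a (the reverse of z), represents all of 𝒵(F).
  covers⇒knotted : ∀ F {z a b c} → Zigzag T z → Covers z F → Spans T F a b c → Occurs z (a , b , c)
                 → LocallyZKnotted T F
  covers⇒knotted F {z} Zz cover sp (i , e) with zigzag-through (spans-reverse sp)
  ... | u , Zu , eu =
    z , u , (Zz , i , spans-≡ (sym e) sp) , (Zu , 0 , spans-≡ (sym eu) (spans-reverse sp)) , z≁u , classes
    where
    z≁u : ¬ SameZ T z u
    z≁u zu = not-both Zz (i , e) (same-occurs⁻ zu (0 , eu))
    classes : ∀ v → Zigzag T v → InZ T F v → SameZ T z v ⊎ SameZ T u v
    classes v Zv (i′ , sp′) with cover sp′
    ... | inj₁ (s , es) = inj₁ (same-from-shared-triple {i = i′} {s} Zz Zv (sym es))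
    ... | inj₂ o with reverse-occurs {i = i} {0} Zz Zu (trans e (sym (cong reverse eu))) o
    ...   | g , eg = inj₂ (same-from-shared-triple {i = i′} {g} Zu Zv (sym eg))

  covering⇒knotted : ∀ F {z} → Zigzag T z → Covers z F → LocallyZKnotted T F
  covering⇒knotted F Zz cover with corners-span F (Fin.zero) (Fin.suc Fin.zero) (λ ())
  ... | _ , sp with cover sp
  ...   | inj₁ o = covers⇒knotted F Zz cover sp o
  ...   | inj₂ o = covers⇒knotted F Zz cover (spans-reverse sp) o

lemma3 : (T : Triangulation) (F : Fin (Triangulation.m T)) →
    (LocallyZKnotted T F →
      ∀ z → Zigzag T z → InZ T F z →
      ∀ j k → j ≢ k →
      PassesTwice T z (Triangulation.corner T F j) (Triangulation.corner T F k))
    × ((Σ (ℕ → Fin (Triangulation.n T)) λ z → Zigzag T z ×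
          (∀ j k → j ≢ k →
            PassesTwice T z (Triangulation.corner T F j) (Triangulation.corner T F k)))
       → LocallyZKnotted T F)
lemma3 T F = knotted⇒passes-twice , passes-twice⇒knotted
  where
  knotted⇒passes-twice : LocallyZKnotted T F → ∀ z → Zigzag T z → InZ T F z → ∀ j k → j ≢ k
                       → PassesTwice T z (Triangulation.corner T F j) (Triangulation.corner T F k)
  knotted⇒passes-twice knotted z Zz z∈F = covers⇒passes-twice T F Zz (knotted⇒covers T F knotted Zz z∈F)
  passes-twice⇒knotted : (Σ (ℕ → Fin (Triangulation.n T)) λ z → Zigzag T z ×
                            (∀ j k → j ≢ k → PassesTwice T z (Triangulation.corner T F j) (Triangulation.corner T F k)))
                       → LocallyZKnotted T F
  passes-twice⇒knotted (z , Zz , twice) = covering⇒knotted T F Zz (passes-twice⇒covers T F Zz twice)
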